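{- For $1\le e\ll n^2$ we have $\mathrm{un}_4(n,e)=1$. That is, there is an absolute constant $c>0$ such that for all sufficiently large $n$ and all integers $1\le e\le cn^2$, $\mathrm{un}_4(n,e)=1$.
   Context: A $4$-graph is a $4$-uniform hypergraph. A $4$-graph $\mathcal{H}$ is $(n,e)$-unavoidable if every $4$-graph on $n$ vertices with $e$ edges contains a copy of $\mathcal{H}$; $\mathrm{un}_4(n,e)$ is the maximum number of edges of an $(n,e)$-unavoidable $4$-graph. -}

module Defs where

open import Data.Nat using (ℕ; _≤_)
open import Data.Fin using (Fin)
open import Data.Fin.Subset using (Subset; _∈_; ∣_∣)
open import Data.List using (List; length)
open import Data.List.Relation.Unary.All using (All)
open import Data.List.Relation.Unary.Any using (Any)
open import Data.List.Relation.Unary.Unique.Propositional using (Unique)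
open import Data.Product using (Σ; ∃; _×_)
open import Function.Bundles using (_⇔_)
open import Function.Definitions using (Injective)
open import Relation.Binary.PropositionalEquality using (_≡_)

record Graph4 (v : ℕ) : Set where
  field
    edges    : List (Subset v)
    distinct : Unique edges
    uniform  : All (λ S → ∣ S ∣ ≡ 4) edges
open Graph4 public

e[_] : ∀ {v} → Graph4 v → ℕ
e[ G ] = length (edges G)

ImageIs : ∀ {k n} → (Fin k → Fin n) → Subset k → Subset n → Set
ImageIs f S T = ∀ j → (j ∈ T) ⇔ (∃ λ i → i ∈ S × f i ≡ j)

Contains : ∀ {n k} → Graph4 n → Graph4 k → Set
Contains {n} {k} G H =
  Σ (Fin k → Fin n) λ f → Injective _≡_ _≡_ f ×
    All (λ S → Any (λ T → ImageIs f S T) (edges G)) (edges H)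

Unavoidable : ℕ → ℕ → ∀ {k} → Graph4 k → Set
Unavoidable n e H = (G : Graph4 n) → e[ G ] ≡ e → Contains G H

Un4≡ : ℕ → ℕ → ℕ → Set
Un4≡ n e m =
  (Σ ℕ λ k → Σ (Graph4 k) λ H → Unavoidable n e H × e[ H ] ≡ m) ×
  (∀ k (H : Graph4 k) → Unavoidable n e H → e[ H ] ≤ m)

module Submission where

-- An (n,e)-unavoidable 4-graph H embeds into every 4-graph with e edges, in particular into
-- two extreme ones: a linear graph, in which two edges share at most one vertex, and a pencil,
-- in which all edges contain two fixed vertices. Both properties pass from a graph to every
-- graph embedded in it, and a graph that has both has at most one edge. For e ≤ k² and
-- 16k ≤ n both graphs exist: in the grid Fin 4 × Fin 4k take the e lines x = a + s·b, and in
-- Fin 4 × Fin (k+1) the e edges {(0,0), (1,0), (2,a+1), (3,b+1)}. Conversely a single edge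
-- embeds into every nonempty 4-graph. Taking k = ⌊n/16⌋ gives the constant c = 1/1024.

open import Defs
open import Data.Nat using (ℕ; zero; suc; _+_; _*_; _≤_; _<_; z≤n; _/_; _%_)
open import Data.Nat.Properties
  using ( ≤-refl; ≤-trans; <⇒≤; <-cmp; m≤m+n; m≤n⇒∃[o]m+o≡n; module ≤-Reasoning
        ; +-comm; +-identityʳ; +-cancelˡ-≡; +-cancelʳ-≡; +-monoˡ-≤; +-monoʳ-≤; +-mono-<-≤
        ; *-cancelˡ-≡; *-cancelʳ-≤; *-mono-≤; *-monoˡ-≤ )
open import Data.Nat.DivMod using (m/n*n≤m; m≥n⇒m/n>0; m≡m%n+[m/n]*n; m%n<n)
open import Data.Nat.Solver using (module +-*-Solver)
open import Data.Fin using (Fin; zero; suc; toℕ; fromℕ<; inject≤; combine; remQuot)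
open import Data.Fin.Properties
  using ( suc-injective; toℕ-injective; toℕ<n; toℕ≤pred[n]; fromℕ<-injective
        ; inject≤-injective; combine-injective; combine-remQuot )
open import Data.Fin.Subset using (Subset; _∈_; _∉_; ∣_∣; inside; outside; ⊤; ⊥; ⁅_⁆; _∪_; _⊆_)
open import Data.Fin.Subset.Properties
  using (∈⊤; ∉⊥; ∣⊥∣≡0; ⊆-antisym; ∪-identityˡ; x∈⁅x⁆; x∈⁅y⁆⇒x≡y; x∈p∪q⁺; x∈p∪q⁻)
open import Data.Vec using (_∷_; here; there)
open import Data.List using (List; []; _∷_; length; tabulate)
open import Data.List.Properties using (length-tabulate)
open import Data.List.Membership.Propositional using (find) renaming (_∈_ to _∈ₗ_)
open import Data.List.Relation.Unary.All using ([]; _∷_)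
import Data.List.Relation.Unary.All as All
import Data.List.Relation.Unary.All.Properties as All
open import Data.List.Relation.Unary.Any using (here; there)
import Data.List.Relation.Unary.Any.Properties as Any
open import Data.List.Relation.Unary.Unique.Propositional using (Unique)
import Data.List.Relation.Unary.Unique.Propositional.Properties as Unique
open import Data.List.Relation.Unary.AllPairs using ([]; _∷_)
open import Data.Product using (Σ; ∃; ∃₂; _×_; _,_; proj₁; proj₂; uncurry)
open import Data.Sum using (inj₁; inj₂)
open import Function using (_∘_)
open import Function.Bundles using (mk⇔; Equivalence)
open import Function.Definitions using (Injective)
open import Relation.Nullary using (contradiction)
open import Relation.Binary.PropositionalEquality
open import Relation.Binary.Definitions using (tri<; tri≈; tri>)

private variable m n : ℕ

image : (Fin m → Fin n) → Subset n
image {zero}  f = ⊥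
image {suc m} f = ⁅ f zero ⁆ ∪ image (f ∘ suc)

∈-image⁺ : (f : Fin m → Fin n) (i : Fin m) → f i ∈ image f
∈-image⁺ f zero    = x∈p∪q⁺ (inj₁ (x∈⁅x⁆ (f zero)))
∈-image⁺ f (suc i) = x∈p∪q⁺ (inj₂ (∈-image⁺ (f ∘ suc) i))

∈-image⁻ : (f : Fin m → Fin n) {x : Fin n} → x ∈ image f → ∃ λ i → f i ≡ x
∈-image⁻ {zero}  f x∈ = contradiction x∈ ∉⊥
∈-image⁻ {suc m} f x∈ with x∈p∪q⁻ ⁅ f zero ⁆ (image (f ∘ suc)) x∈
... | inj₁ x∈⁅f0⁆ = zero , sym (x∈⁅y⁆⇒x≡y _ x∈⁅f0⁆)
... | inj₂ x∈img  with i , fi≡x ← ∈-image⁻ (f ∘ suc) x∈img = suc i , fi≡x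

x∉p⇒∣⁅x⁆∪p∣≡1+∣p∣ : {x : Fin n} {p : Subset n} → x ∉ p → ∣ ⁅ x ⁆ ∪ p ∣ ≡ suc ∣ p ∣
x∉p⇒∣⁅x⁆∪p∣≡1+∣p∣ {x = zero}  {outside ∷ p} _   = cong (suc ∘ ∣_∣) (∪-identityˡ p)
x∉p⇒∣⁅x⁆∪p∣≡1+∣p∣ {x = zero}  {inside  ∷ p} x∉p = contradiction here x∉p
x∉p⇒∣⁅x⁆∪p∣≡1+∣p∣ {x = suc x} {outside ∷ p} x∉p = x∉p⇒∣⁅x⁆∪p∣≡1+∣p∣ (x∉p ∘ there)
x∉p⇒∣⁅x⁆∪p∣≡1+∣p∣ {x = suc x} {inside  ∷ p} x∉p = cong suc (x∉p⇒∣⁅x⁆∪p∣≡1+∣p∣ (x∉p ∘ there))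

∣image∣ : (f : Fin m → Fin n) → Injective _≡_ _≡_ f → ∣ image f ∣ ≡ m
∣image∣ {zero}  {n} f _     = ∣⊥∣≡0 n
∣image∣ {suc m}     f f-inj =
  trans (x∉p⇒∣⁅x⁆∪p∣≡1+∣p∣ f0∉) (cong suc (∣image∣ (f ∘ suc) (suc-injective ∘ f-inj)))
  where
  f0∉ : f zero ∉ image (f ∘ suc)
  f0∉ f0∈ with i , fi≡f0 ← ∈-image⁻ (f ∘ suc) f0∈ with () ← f-inj fi≡f0

enumerate : (p : Subset n) → Fin ∣ p ∣ → Fin n
enumerate (outside ∷ p) i       = suc (enumerate p i)
enumerate (inside  ∷ p) zero    = zero
enumerate (inside  ∷ p) (suc i) = suc (enumerate p i)

enumerate-injective : (p : Subset n) → Injective _≡_ _≡_ (enumerate p)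
enumerate-injective (outside ∷ p)                 eq = enumerate-injective p (suc-injective eq)
enumerate-injective (inside  ∷ p) {zero}  {zero}  _  = refl
enumerate-injective (inside  ∷ p) {suc i} {suc j} eq =
  cong suc (enumerate-injective p (suc-injective eq))

enumerate-∈ : (p : Subset n) (i : Fin ∣ p ∣) → enumerate p i ∈ p
enumerate-∈ (outside ∷ p) i       = there (enumerate-∈ p i)
enumerate-∈ (inside  ∷ p) zero    = here
enumerate-∈ (inside  ∷ p) (suc i) = there (enumerate-∈ p i)

∈⇒enumerated : (p : Subset n) {x : Fin n} → x ∈ p → ∃ λ i → enumerate p i ≡ x
∈⇒enumerated (inside  ∷ p) here        = zero , refl
∈⇒enumerated (outside ∷ p) (there x∈p) with i , eq ← ∈⇒enumerated p x∈p = i , cong suc eq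
∈⇒enumerated (inside  ∷ p) (there x∈p) with i , eq ← ∈⇒enumerated p x∈p = suc i , cong suc eq

ImageIs-enumerate : (p : Subset n) → ImageIs (enumerate p) ⊤ p
ImageIs-enumerate p j = mk⇔
  (λ j∈p → let i , eq = ∈⇒enumerated p j∈p in i , ∈⊤ , eq)
  (λ { (i , _ , refl) → enumerate-∈ p i })

∣p∣≡m⇒enumeration : (p : Subset n) → ∣ p ∣ ≡ m →
                    Σ (Fin m → Fin n) λ f → Injective _≡_ _≡_ f × ImageIs f ⊤ p
∣p∣≡m⇒enumeration p refl = enumerate p , enumerate-injective p , ImageIs-enumerate p

module _ {f : Fin m → Fin n} where

  ∈-ImageIs⁺ : ∀ {S T i} → ImageIs f S T → i ∈ S → f i ∈ T
  ∈-ImageIs⁺ {i = i} img i∈S = Equivalence.from (img (f i)) (i , i∈S , refl)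

  ∈-ImageIs⁻ : ∀ {S T x} → ImageIs f S T → x ∈ T → ∃ λ i → i ∈ S × f i ≡ x
  ∈-ImageIs⁻ {x = x} img = Equivalence.to (img x)

  ImageIs-injective : Injective _≡_ _≡_ f → ∀ {S S′ T} → ImageIs f S T → ImageIs f S′ T → S ≡ S′
  ImageIs-injective f-inj img img′ = ⊆-antisym (⊆ img img′) (⊆ img′ img)
    where
    ⊆ : ∀ {S S′ T} → ImageIs f S T → ImageIs f S′ T → S ⊆ S′
    ⊆ img img′ x∈S with i , i∈S′ , fi≡fx ← ∈-ImageIs⁻ img′ (∈-ImageIs⁺ img x∈S)
      = subst (_∈ _) (f-inj fi≡fx) i∈S′

SharePair : Subset n → Subset n → Set
SharePair S T = ∃₂ λ x y → x ≢ y × (x ∈ S × x ∈ T) × (y ∈ S × y ∈ T)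

Linear : Graph4 n → Set
Linear G = ∀ {S T} → S ∈ₗ edges G → T ∈ₗ edges G → SharePair S T → S ≡ T

TwoIntersecting : Graph4 n → Set
TwoIntersecting G = ∀ {S T} → S ∈ₗ edges G → T ∈ₗ edges G → SharePair S T

module _ {f : Fin m → Fin n} (f-inj : Injective _≡_ _≡_ f)
         {S S′ T T′} (img : ImageIs f S T) (img′ : ImageIs f S′ T′) where

  SharePair-image : SharePair S S′ → SharePair T T′
  SharePair-image (x , y , x≢y , (x∈S , x∈S′) , (y∈S , y∈S′)) =
    f x , f y , x≢y ∘ f-inj ,
    (∈-ImageIs⁺ img x∈S , ∈-ImageIs⁺ img′ x∈S′) , (∈-ImageIs⁺ img y∈S , ∈-ImageIs⁺ img′ y∈S′)

  common-preimage : ∀ {x} → x ∈ T → x ∈ T′ → ∃ λ i → f i ≡ x × i ∈ S × i ∈ S′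
  common-preimage x∈T x∈T′
    with i , i∈S , fi≡x ← ∈-ImageIs⁻ img x∈T | i′ , i′∈S′ , fi′≡x ← ∈-ImageIs⁻ img′ x∈T′
    = i , fi≡x , i∈S , subst (_∈ S′) (f-inj (trans fi′≡x (sym fi≡x))) i′∈S′

  SharePair-preimage : SharePair T T′ → SharePair S S′
  SharePair-preimage (x , y , x≢y , (x∈T , x∈T′) , (y∈T , y∈T′))
    with i , fi≡x , i∈S , i∈S′ ← common-preimage x∈T x∈T′
       | j , fj≡y , j∈S , j∈S′ ← common-preimage y∈T y∈T′
    = i , j , (λ { refl → x≢y (trans (sym fi≡x) fj≡y) }) , (i∈S , i∈S′) , (j∈S , j∈S′)

module _ {k} {G : Graph4 n} {H : Graph4 k} (H⊆G : Contains G H) where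

  private
    f-inj : Injective _≡_ _≡_ (proj₁ H⊆G)
    f-inj = proj₁ (proj₂ H⊆G)

  mapped-edge : ∀ {S} → S ∈ₗ edges H → ∃ λ T → T ∈ₗ edges G × ImageIs (proj₁ H⊆G) S T
  mapped-edge = find ∘ All.lookup (proj₂ (proj₂ H⊆G))

  Linear-contained : Linear G → Linear H
  Linear-contained G-linear S∈H S′∈H shared
    with T , T∈G , img ← mapped-edge S∈H | T′ , T′∈G , img′ ← mapped-edge S′∈H
    with refl ← G-linear T∈G T′∈G (SharePair-image f-inj img img′ shared)
    = ImageIs-injective f-inj img img′

  TwoIntersecting-contained : TwoIntersecting G → TwoIntersecting H
  TwoIntersecting-contained G-two S∈H S′∈H
    with T , T∈G , img ← mapped-edge S∈H | T′ , T′∈G , img′ ← mapped-edge S′∈H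
    = SharePair-preimage f-inj img img′ (G-two T∈G T′∈G)

Unique∧constant⇒length≤1 : ∀ {A : Set} {L : List A} →
                           Unique L → (∀ {x y} → x ∈ₗ L → y ∈ₗ L → x ≡ y) → length L ≤ 1
Unique∧constant⇒length≤1 {L = []}         _                 _         = z≤n
Unique∧constant⇒length≤1 {L = _ ∷ []}     _                 _         = ≤-refl
Unique∧constant⇒length≤1 {L = _ ∷ _ ∷ _} ((x≢y ∷ _) ∷ _) all-equal =
  contradiction (all-equal (here refl) (there (here refl))) x≢y

Linear∧TwoIntersecting⇒e≤1 : {H : Graph4 n} → Linear H → TwoIntersecting H → e[ H ] ≤ 1
Linear∧TwoIntersecting⇒e≤1 {H = H} H-linear H-two =
  Unique∧constant⇒length≤1 (distinct H) (λ S∈H T∈H → H-linear S∈H T∈H (H-two S∈H T∈H))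

K4 : Graph4 4
K4 = record { edges = ⊤ ∷ [] ; distinct = [] ∷ [] ; uniform = refl ∷ [] }

K4-unavoidable : ∀ {e} → 1 ≤ e → Unavoidable n e K4
K4-unavoidable 1≤e G refl with edges G | uniform G | 1≤e
... | T ∷ _ | ∣T∣≡4 ∷ _ | _ with f , f-inj , img ← ∣p∣≡m⇒enumeration T ∣T∣≡4 =
  f , f-inj , here img ∷ []

un4≡1 : ∀ {e} → 1 ≤ e →
        (Σ (Graph4 n) λ G → Linear G × e[ G ] ≡ e) →
        (Σ (Graph4 n) λ G → TwoIntersecting G × e[ G ] ≡ e) →
        Un4≡ n e 1
un4≡1 1≤e (G , G-linear , ∣G∣≡e) (G′ , G′-two , ∣G′∣≡e) =
  (4 , K4 , K4-unavoidable 1≤e , refl) ,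
  λ _ H H-unavoidable → Linear∧TwoIntersecting⇒e≤1 {H = H}
    (Linear-contained {G = G} {H} (H-unavoidable G ∣G∣≡e) G-linear)
    (TwoIntersecting-contained {G = G′} {H} (H-unavoidable G′ ∣G′∣≡e) G′-two)

module _ {e : ℕ} (E : Fin e → Subset n) (E-injective : Injective _≡_ _≡_ E)
         (E-uniform : ∀ i → ∣ E i ∣ ≡ 4) where

  familyGraph : Graph4 n
  familyGraph = record
    { edges    = tabulate E
    ; distinct = Unique.tabulate⁺ E-injective
    ; uniform  = All.tabulate⁺ E-uniform
    }

  e[familyGraph] : e[ familyGraph ] ≡ e
  e[familyGraph] = length-tabulate E

  ∈-familyGraph : ∀ {S} → S ∈ₗ edges familyGraph → ∃ λ i → S ≡ E i
  ∈-familyGraph = Any.tabulate⁻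

-- The vertices form the grid Fin 4 × Fin V (column s, height x), and the edge of
-- ℓ : Fin 4 → Fin V is its graph: the vertex at height ℓ s in each column s.
module Grid {V : ℕ} (V*4≤n : V * 4 ≤ n) where

  vertex : Fin 4 → Fin V → Fin n
  vertex s x = inject≤ (combine x s) V*4≤n

  vertex-injective : ∀ {s t x y} → vertex s x ≡ vertex t y → s ≡ t × x ≡ y
  vertex-injective {s} {t} {x} {y} eq
    with x≡y , s≡t ← combine-injective x s y t (inject≤-injective _ _ _ _ eq) = s≡t , x≡y

  vertexOf : (Fin 4 → Fin V) → Fin 4 → Fin n
  vertexOf ℓ s = vertex s (ℓ s)

  edge : (Fin 4 → Fin V) → Subset n
  edge ℓ = image (vertexOf ℓ)

  ∣edge∣ : ∀ ℓ → ∣ edge ℓ ∣ ≡ 4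
  ∣edge∣ ℓ = ∣image∣ (vertexOf ℓ) (proj₁ ∘ vertex-injective)

  ∈-edge⁺ : ∀ ℓ s → vertexOf ℓ s ∈ edge ℓ
  ∈-edge⁺ ℓ = ∈-image⁺ (vertexOf ℓ)

  ∈-edge⁻ : ∀ ℓ {s x} → vertex s x ∈ edge ℓ → ℓ s ≡ x
  ∈-edge⁻ ℓ x∈ with t , eq ← ∈-image⁻ (vertexOf ℓ) x∈ with refl , ℓt≡x ← vertex-injective eq = ℓt≡x

  edge-injective : ∀ {ℓ ℓ′} → edge ℓ ≡ edge ℓ′ → ∀ s → ℓ s ≡ ℓ′ s
  edge-injective {ℓ} {ℓ′} eq s = sym (∈-edge⁻ ℓ′ (subst (_ ∈_) eq (∈-edge⁺ ℓ s)))

  SharePair-edge : ∀ {ℓ ℓ′} → SharePair (edge ℓ) (edge ℓ′) →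
                   ∃₂ λ s t → s ≢ t × ℓ s ≡ ℓ′ s × ℓ t ≡ ℓ′ t
  SharePair-edge {ℓ} {ℓ′} (x , y , x≢y , (x∈ , x∈′) , (y∈ , y∈′))
    with s , refl ← ∈-image⁻ (vertexOf ℓ) x∈ | t , refl ← ∈-image⁻ (vertexOf ℓ) y∈
    = s , t , (λ { refl → x≢y refl }) , sym (∈-edge⁻ ℓ′ x∈′) , sym (∈-edge⁻ ℓ′ y∈′)

pairIndex : ∀ {e} k → e ≤ k * k → Fin e → Fin k × Fin k
pairIndex k e≤k² i = remQuot {k} k (inject≤ i e≤k²)

pairIndex-injective : ∀ {e} k (e≤k² : e ≤ k * k) → Injective _≡_ _≡_ (pairIndex k e≤k²)
pairIndex-injective k e≤k² {i} {j} eq = inject≤-injective e≤k² e≤k² i j (begin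
  inject≤ i e≤k²                                   ≡⟨ combine-remQuot {k} k (inject≤ i e≤k²) ⟨
  uncurry combine (remQuot {k} k (inject≤ i e≤k²)) ≡⟨ cong (uncurry combine) eq ⟩
  uncurry combine (remQuot {k} k (inject≤ j e≤k²)) ≡⟨ combine-remQuot {k} k (inject≤ j e≤k²) ⟩
  inject≤ j e≤k²                                   ∎)
  where open ≡-Reasoning

module GridGraph (k : ℕ) {V e : ℕ} (V*4≤n : V * 4 ≤ n) (e≤k² : e ≤ k * k)
                 (ℓ : Fin k × Fin k → Fin 4 → Fin V)
                 (ℓ-injective : ∀ {p p′} → (∀ s → ℓ p s ≡ ℓ p′ s) → p ≡ p′) where

  open Grid {V = V} V*4≤n

  E : Fin e → Subset n
  E = edge ∘ ℓ ∘ pairIndex k e≤k²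

  E-injective : Injective _≡_ _≡_ E
  E-injective = pairIndex-injective k e≤k² ∘ ℓ-injective ∘ edge-injective

  E-uniform : ∀ i → ∣ E i ∣ ≡ 4
  E-uniform = ∣edge∣ ∘ ℓ ∘ pairIndex k e≤k²

  graph : Graph4 n
  graph = familyGraph E E-injective E-uniform

  e[graph] : e[ graph ] ≡ e
  e[graph] = e[familyGraph] E E-injective E-uniform

  ∈-graph : ∀ {S} → S ∈ₗ edges graph → ∃ λ i → S ≡ E i
  ∈-graph = ∈-familyGraph E E-injective E-uniform

  linear : (∀ {p p′ s t} → s ≢ t → ℓ p s ≡ ℓ p′ s → ℓ p t ≡ ℓ p′ t → p ≡ p′) → Linear graph
  linear two-coordinates-determine S∈ T∈ shared
    with i , refl ← ∈-graph S∈ | j , refl ← ∈-graph T∈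
    with s , t , s≢t , ℓs≡ , ℓt≡ ← SharePair-edge shared
    = cong (edge ∘ ℓ) (two-coordinates-determine s≢t ℓs≡ ℓt≡)

  twoIntersecting : ∀ {s t} → s ≢ t → (∀ p p′ → ℓ p s ≡ ℓ p′ s) → (∀ p p′ → ℓ p t ≡ ℓ p′ t) →
                    TwoIntersecting graph
  twoIntersecting {s} {t} s≢t s-constant t-constant S∈ T∈
    with i , refl ← ∈-graph S∈ | j , refl ← ∈-graph T∈
    = vertexOf (ℓ p) s , vertexOf (ℓ p) t , s≢t ∘ proj₁ ∘ vertex-injective ,
      (∈-edge⁺ (ℓ p) s , shared s s-constant) , (∈-edge⁺ (ℓ p) t , shared t t-constant)
    where
    p p′ : Fin k × Fin k
    p  = pairIndex k e≤k² i
    p′ = pairIndex k e≤k² j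
    shared : ∀ u → (∀ p p′ → ℓ p u ≡ ℓ p′ u) → vertexOf (ℓ p) u ∈ edge (ℓ p′)
    shared u u-constant =
      subst (λ x → vertex u x ∈ edge (ℓ p′)) (u-constant p′ p) (∈-edge⁺ (ℓ p′) u)

affine-injective-< : ∀ s d {a b a′ b′} → a + s * b ≡ a′ + s * b′ →
                     a + (suc s + d) * b ≡ a′ + (suc s + d) * b′ → a ≡ a′ × b ≡ b′
affine-injective-< s d {a} {b} {a′} {b′} eqₛ eqₜ = a≡a′ , b≡b′
  where
  open ≡-Reasoning
  open +-*-Solver
  split : ∀ x y → x + (suc s + d) * y ≡ (x + s * y) + suc d * y
  split x y = solve 4
    (λ x y s d → x :+ (con 1 :+ s :+ d) :* y := (x :+ s :* y) :+ (con 1 :+ d) :* y) refl x y s d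
  shifted : (a′ + s * b′) + suc d * b ≡ (a′ + s * b′) + suc d * b′
  shifted = begin
    (a′ + s * b′) + suc d * b   ≡⟨ cong (_+ suc d * b) eqₛ ⟨
    (a + s * b) + suc d * b     ≡⟨ split a b ⟨
    a + (suc s + d) * b         ≡⟨ eqₜ ⟩
    a′ + (suc s + d) * b′       ≡⟨ split a′ b′ ⟩
    (a′ + s * b′) + suc d * b′  ∎
  b≡b′ : b ≡ b′
  b≡b′ = *-cancelˡ-≡ b b′ (suc d) (+-cancelˡ-≡ (a′ + s * b′) _ _ shifted)
  a≡a′ : a ≡ a′
  a≡a′ = +-cancelʳ-≡ (s * b) a a′ (trans eqₛ (cong (λ z → a′ + s * z) (sym b≡b′)))

affine-injective : ∀ {s t a b a′ b′} → s ≢ t →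
                   a + s * b ≡ a′ + s * b′ → a + t * b ≡ a′ + t * b′ → a ≡ a′ × b ≡ b′
affine-injective {s} {t} s≢t eqₛ eqₜ with <-cmp s t
... | tri< s<t _ _ with d , refl ← m≤n⇒∃[o]m+o≡n s<t = affine-injective-< s d eqₛ eqₜ
... | tri≈ _ s≡t _ = contradiction s≡t s≢t
... | tri> _ _ t<s with d , refl ← m≤n⇒∃[o]m+o≡n t<s = affine-injective-< t d eqₜ eqₛ

affine-< : ∀ {k} (a b : Fin k) (s : Fin 4) → toℕ a + toℕ s * toℕ b < 4 * k
affine-< a b s = +-mono-<-≤ (toℕ<n a) (*-mono-≤ (toℕ≤pred[n] s) (<⇒≤ (toℕ<n b)))

affine : ∀ {k} → Fin k × Fin k → Fin 4 → Fin (4 * k)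
affine (a , b) s = fromℕ< (affine-< a b s)

affine-two-coordinates : ∀ {k} {p p′ : Fin k × Fin k} {s t} → s ≢ t →
                         affine p s ≡ affine p′ s → affine p t ≡ affine p′ t → p ≡ p′
affine-two-coordinates {p = a , b} {a′ , b′} {s} {t} s≢t eqₛ eqₜ
  with a≡a′ , b≡b′ ← affine-injective (s≢t ∘ toℕ-injective)
                       (fromℕ<-injective _ _ (affine-< a b s) (affine-< a′ b′ s) eqₛ)
                       (fromℕ<-injective _ _ (affine-< a b t) (affine-< a′ b′ t) eqₜ)
  = cong₂ _,_ (toℕ-injective a≡a′) (toℕ-injective b≡b′)

linearGraph : ∀ k {e} → 4 * k * 4 ≤ n → e ≤ k * k → Σ (Graph4 n) λ G → Linear G × e[ G ] ≡ e
linearGraph k fits e≤k² = graph , linear affine-two-coordinates , e[graph]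
  where
  open GridGraph k fits e≤k² affine
         (λ eq → affine-two-coordinates {s = zero} {suc zero} (λ ()) (eq zero) (eq (suc zero)))

pencil : ∀ {k} → Fin k × Fin k → Fin 4 → Fin (suc k)
pencil (a , b) (suc (suc zero))       = suc a
pencil (a , b) (suc (suc (suc zero))) = suc b
pencil _       _                      = zero

pencil-injective : ∀ {k} {p p′ : Fin k × Fin k} → (∀ s → pencil p s ≡ pencil p′ s) → p ≡ p′
pencil-injective eq =
  cong₂ _,_ (suc-injective (eq (suc (suc zero)))) (suc-injective (eq (suc (suc (suc zero)))))

twoIntersectingGraph : ∀ k {e} → suc k * 4 ≤ n → e ≤ k * k →
                       Σ (Graph4 n) λ G → TwoIntersecting G × e[ G ] ≡ e
twoIntersectingGraph k fits e≤k² =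
  graph , twoIntersecting {zero} {suc zero} (λ ()) (λ _ _ → refl) (λ _ _ → refl) , e[graph]
  where
  open GridGraph k fits e≤k² pencil pencil-injective

vertexBudget : ∀ {e} → 16 ≤ n → e * 1024 ≤ n * n →
               ∃ λ k → e ≤ k * k × 4 * k * 4 ≤ n × suc k * 4 ≤ n
vertexBudget {n} {e} 16≤n e*1024≤n² =
  k , e≤k² , affine-fits , ≤-trans (*-monoˡ-≤ 4 1+k≤4k) affine-fits
  where
  open ≤-Reasoning
  open +-*-Solver
  k : ℕ
  k = n / 16
  1≤k : 1 ≤ k
  1≤k = m≥n⇒m/n>0 16≤n
  affine-fits : 4 * k * 4 ≤ n
  affine-fits = begin
    4 * k * 4 ≡⟨ solve 1 (λ k → con 4 :* k :* con 4 := k :* con 16) refl k ⟩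
    k * 16    ≤⟨ m/n*n≤m n 16 ⟩
    n         ∎
  1+k≤4k : suc k ≤ 4 * k
  1+k≤4k = begin
    suc k ≡⟨ +-comm 1 k ⟩
    k + 1 ≤⟨ +-monoʳ-≤ k (≤-trans 1≤k (m≤m+n k (2 * k))) ⟩
    4 * k ∎
  n≤32k : n ≤ k * 32
  n≤32k = begin
    n               ≡⟨ m≡m%n+[m/n]*n n 16 ⟩
    n % 16 + k * 16 ≤⟨ +-monoˡ-≤ (k * 16) (<⇒≤ (m%n<n n 16)) ⟩
    16 + k * 16     ≤⟨ +-monoˡ-≤ (k * 16) (*-monoˡ-≤ 16 1≤k) ⟩
    k * 16 + k * 16 ≡⟨ solve 1 (λ k → k :* con 16 :+ k :* con 16 := k :* con 32) refl k ⟩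
    k * 32          ∎
  e≤k² : e ≤ k * k
  e≤k² = *-cancelʳ-≤ e (k * k) 1024 (begin
    e * 1024          ≤⟨ e*1024≤n² ⟩
    n * n             ≤⟨ *-mono-≤ n≤32k n≤32k ⟩
    k * 32 * (k * 32) ≡⟨ solve 1 (λ k → k :* con 32 :* (k :* con 32) := k :* k :* con 1024) refl k ⟩
    k * k * 1024      ∎)

theorem4p1 : Σ ℕ λ p → Σ ℕ λ q → Σ ℕ λ N →
    ∀ n → N ≤ n → ∀ e → 1 ≤ e → e * suc q ≤ suc p * (n * n) → Un4≡ n e 1
theorem4p1 = 0 , 1023 , 16 , λ n 16≤n e 1≤e e*1024≤n² →
  let k , e≤k² , affine-fits , pencil-fits =
        vertexBudget 16≤n (subst (e * 1024 ≤_) (+-identityʳ (n * n)) e*1024≤n²)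
  in un4≡1 1≤e (linearGraph k affine-fits e≤k²) (twoIntersectingGraph k pencil-fits e≤k²)
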